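{- Let $G$ be any finite simple graph of order $n$ and size $m$, with vertex set $\{v_1,\dots,v_n\}$, and let $G\circ K_1$ be the graph obtained from $G$ by adding $n$ new vertices $u_1,\dots,u_n$ and the edges $\{v_i,u_i\}$ for $1\le i\le n$. Then for every $i$ with $n\le i\le n+m$, $e(G\circ K_1,i)=\binom{m}{i-n}$. Hence $E(G\circ K_1,x)=x^n(1+x)^m$.
   Context: An edge covering of a graph with no isolated vertex is a set of edges such that every vertex is incident with at least one edge of the set. For a graph $H$ of size $m_H$, $e(H,i)$ denotes the number of edge coverings of $H$ of cardinality $i$, $\rho(H)$ is the minimum size of an edge covering, and the edge cover polynomial is $E(H,x)=\sum_{i=\rho(H)}^{m_H} e(H,i)x^i$; by convention $E(H,x)=0$ if $H$ has an isolated vertex, and $E(H,x)=1$ if $H$ has no vertices and no edges. -}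

module Defs where

open import Data.Nat using (ℕ; zero; suc; _+_; _*_; _≟_)
open import Data.Fin using (Fin; zero; suc; splitAt; _↑ˡ_; _↑ʳ_)
open import Data.Fin.Properties using (all?; any?)
open import Data.Fin.Subset using (Subset; _∈_; ∣_∣; inside; outside)
open import Data.Fin.Subset.Properties using (_∈?_)
open import Data.Product using (_×_; _,_; proj₁; proj₂; ∃)
open import Data.Product.Properties using () 
open import Relation.Nullary.Decidable using (_×-dec_; _⊎-dec_)
open import Data.Sum using (_⊎_; inj₁; inj₂)
open import Data.List using (List; []; _∷_; _++_; map; filter; length; replicate)
open import Data.Vec using (Vec; []; _∷_)
open import Relation.Binary.PropositionalEquality using (_≡_; _≢_)
open import Relation.Nullary using (Dec)
import Data.Fin.Properties as FinP

-- A (multi)graph with vertex set Fin n and edges indexed by Fin m;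
-- edge k joins the two endpoints (edges k).
Edges : ℕ → ℕ → Set
Edges n m = Fin m → Fin n × Fin n

SameEdge : {n : ℕ} → Fin n × Fin n → Fin n × Fin n → Set
SameEdge (a , b) (c , d) = (a ≡ c × b ≡ d) ⊎ (a ≡ d × b ≡ c)

record SimpleGraph (n m : ℕ) : Set where
  field
    edge     : Edges n m
    loopless : ∀ k → proj₁ (edge k) ≢ proj₂ (edge k)
    distinct : ∀ k l → SameEdge (edge k) (edge l) → k ≡ l
open SimpleGraph public

Incident : {n : ℕ} → Fin n × Fin n → Fin n → Set
Incident (a , b) v = v ≡ a ⊎ v ≡ b

IsEdgeCover : {n m : ℕ} → Edges n m → Subset m → Set
IsEdgeCover {n} {m} E S = ∀ (v : Fin n) → ∃ λ (k : Fin m) → k ∈ S × Incident (E k) v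

isEdgeCover? : {n m : ℕ} (E : Edges n m) (S : Subset m) → Dec (IsEdgeCover E S)
isEdgeCover? E S = all? λ v → any? λ k → (k ∈? S) ×-dec
  (FinP._≟_ v (proj₁ (E k)) ⊎-dec FinP._≟_ v (proj₂ (E k)))

allSubsets : (m : ℕ) → List (Subset m)
allSubsets zero = [] ∷ []
allSubsets (suc m) = map (inside ∷_) (allSubsets m) ++ map (outside ∷_) (allSubsets m)

e : {n m : ℕ} → Edges n m → ℕ → ℕ
e {n} {m} E i = length (filter (λ S → isEdgeCover? E S ×-dec (∣ S ∣ ≟ i)) (allSubsets m))

-- Polynomials with ℕ coefficients as coefficient lists (constant term first).
Poly : Set
Poly = List ℕ

coeff : Poly → ℕ → ℕ
coeff [] _ = 0
coeff (a ∷ p) zero = a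
coeff (a ∷ p) (suc i) = coeff p i

_≈ₚ_ : Poly → Poly → Set
p ≈ₚ q = ∀ i → coeff p i ≡ coeff q i

_+ₚ_ : Poly → Poly → Poly
[] +ₚ q = q
(a ∷ p) +ₚ [] = a ∷ p
(a ∷ p) +ₚ (b ∷ q) = (a + b) ∷ (p +ₚ q)

_*ₚ_ : Poly → Poly → Poly
[] *ₚ q = []
(a ∷ p) *ₚ q = map (a *_) q +ₚ (0 ∷ (p *ₚ q))

X^ : ℕ → Poly
X^ n = replicate n 0 ++ (1 ∷ [])

_^ₚ_ : Poly → ℕ → Poly
p ^ₚ zero = 1 ∷ []
p ^ₚ suc k = p *ₚ (p ^ₚ k)

range : ℕ → List ℕ
range zero = []
range (suc k) = 0 ∷ map suc (range k)

-- edge cover polynomial E(H,x) = Σ_i e(H,i) x^i  (coefficients for i = 0 .. m_H;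
-- e(H,i) = 0 for i < ρ(H), and all zero if H has an isolated vertex)
EdgeCoverPoly : {n m : ℕ} → Edges n m → Poly
EdgeCoverPoly {n} {m} E = map (e E) (range (suc m))

-- The corona G ∘ K₁: vertices v_i = i ↑ˡ n, u_i = n ↑ʳ i;
-- edges: the m edges of G, followed by the n pendant edges {v_i , u_i}.
corona : {n m : ℕ} → Edges n m → Edges (n + n) (m + n)
corona {n} {m} E k with splitAt m k
... | inj₁ j = (proj₁ (E j) ↑ˡ n) , (proj₂ (E j) ↑ˡ n)
... | inj₂ i = (i ↑ˡ n) , (n ↑ʳ i)

module Submission where

-- In the corona G ∘ K₁ the pendant vertex u_j lies on exactly one edge, the
-- pendant edge {v_j , u_j}, and every vertex lies on some pendant edge.  So a
-- set of edges of G ∘ K₁ is an edge covering iff it contains all n pendant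
-- edges, and an i-element covering amounts to a free choice of i - n of the m
-- edges of G: there are C(m, i - n) of them.
--
-- Both sides of the theorem are expressed through  shift n (m C_) , the
-- sequence i ↦ C(m, i - n) (zero for i < n), which is the coefficient sequence
-- of x^n (1+x)^m.

open import Defs
open import Data.Nat using (ℕ; zero; suc; pred; _+_; _*_; _∸_; _≤_; _<_; s≤s; _≟_; _<?_)
open import Data.Nat.Properties
  using (+-identityʳ; *-identityˡ; *-zeroʳ; +-comm; ≤-trans; <⇒≤; m≤n+m; m+n≤o⇒m≤o∸n; ≮⇒≥)
open import Data.Nat.Combinatorics using (_C_; nCk+nC[k+1]≡[n+1]C[k+1]; k>n⇒nCk≡0)
open import Data.Product using (_×_; _,_; proj₁; proj₂; ∃)
open import Data.Sum using (inj₁; inj₂)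
open import Data.Empty using (⊥-elim)
open import Data.List using (List; []; _∷_; _++_; map; filter; length)
open import Data.List.Properties using (filter-++; length-++; filter-≐; filter-none; map-∘)
open import Data.List.Relation.Unary.All using (universal)
open import Data.Fin using (Fin; zero; suc; splitAt; _↑ˡ_; _↑ʳ_)
open import Data.Fin.Properties
  using (all?; ↑ʳ-injective; splitAt-↑ˡ; splitAt-↑ʳ; splitAt⁻¹-↑ˡ; splitAt⁻¹-↑ʳ)
open import Data.Fin.Subset using (Subset; _∈_; ∣_∣; inside; outside)
open import Data.Fin.Subset.Properties using (_∈?_; drop-there)
open import Data.Vec using (_∷_; here; there)
open import Function using (_∘_)
open import Function.Bundles using (_⇔_; mk⇔; Equivalence)
open import Relation.Binary.PropositionalEquality
  using (_≡_; _≢_; _≗_; refl; sym; trans; cong; cong₂; subst; module ≡-Reasoning)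
open import Relation.Nullary using (¬_; yes; no)
open import Relation.Nullary.Decidable using (_×-dec_)
open import Level using (0ℓ)
open import Relation.Unary using (Pred; Decidable)

-- shift n f is the sequence i ↦ f (i - n), padded with n leading zeros:
-- the coefficient sequence of x^n · F when f is that of F.
shift : ℕ → (ℕ → ℕ) → ℕ → ℕ
shift zero    f i       = f i
shift (suc n) f zero    = 0
shift (suc n) f (suc i) = shift n f i

shift-≥ : ∀ n f {i} → n ≤ i → shift n f i ≡ f (i ∸ n)
shift-≥ zero    f _       = refl
shift-≥ (suc n) f (s≤s p) = shift-≥ n f p

shift-cong : ∀ n {f g} → f ≗ g → shift n f ≗ shift n g
shift-cong zero    f≗g i       = f≗g i
shift-cong (suc n) f≗g zero    = refl
shift-cong (suc n) f≗g (suc i) = shift-cong n f≗g i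

-- f is obtained from g by Pascal's rule, as (1 + x) · G from G.
Pascal : (ℕ → ℕ) → (ℕ → ℕ) → Set
Pascal f g = f 0 ≡ g 0 × (∀ i → f (suc i) ≡ g i + g (suc i))

Pascal-unique : ∀ {f f′ g g′} → Pascal f g → Pascal f′ g′ → g ≗ g′ → f ≗ f′
Pascal-unique (f₀ , _) (f′₀ , _) g≗g′ zero =
  trans f₀ (trans (g≗g′ 0) (sym f′₀))
Pascal-unique (_ , fₛ) (_ , f′ₛ) g≗g′ (suc i) =
  trans (fₛ i) (trans (cong₂ _+_ (g≗g′ i) (g≗g′ (suc i))) (sym (f′ₛ i)))

shift-Pascal : ∀ n {f g} → Pascal f g → Pascal (shift n f) (shift n g)
shift-Pascal zero    p = p
shift-Pascal (suc n) p = refl , step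
  where
  step : ∀ i → shift n _ i ≡ shift (suc n) _ i + shift n _ i
  step zero    = proj₁ (shift-Pascal n p)
  step (suc i) = proj₂ (shift-Pascal n p) i

binomial-Pascal : ∀ m → Pascal (suc m C_) (m C_)
binomial-Pascal m = refl , λ k → sym (nCk+nC[k+1]≡[n+1]C[k+1] m k)


count : ∀ {A : Set} {P : Pred A 0ℓ} → Decidable P → List A → ℕ
count P? xs = length (filter P? xs)

module _ {A : Set} where

  count-≐ : ∀ {P Q : Pred A 0ℓ} (P? : Decidable P) (Q? : Decidable Q) xs →
    (∀ {x} → P x → Q x) → (∀ {x} → Q x → P x) → count P? xs ≡ count Q? xs
  count-≐ P? Q? xs P⊆Q Q⊆P = cong length (filter-≐ P? Q? (P⊆Q , Q⊆P) xs)

  count-none : ∀ {P : Pred A 0ℓ} (P? : Decidable P) xs → (∀ x → ¬ P x) → count P? xs ≡ 0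
  count-none P? xs ¬P = cong length (filter-none P? (universal ¬P xs))

  count-map : ∀ {B : Set} {P : Pred B 0ℓ} (P? : Decidable P) (f : A → B) xs →
    count P? (map f xs) ≡ count (P? ∘ f) xs
  count-map P? f []       = refl
  count-map P? f (x ∷ xs) with P? (f x)
  ... | yes _ = cong suc (count-map P? f xs)
  ... | no _  = count-map P? f xs

-- Every subset of Fin (suc k) either contains 0 or does not.
count-allSubsets : ∀ {k} {P : Pred (Subset (suc k)) 0ℓ} (P? : Decidable P) →
  count P? (allSubsets (suc k))
    ≡ count (P? ∘ (inside ∷_)) (allSubsets k) + count (P? ∘ (outside ∷_)) (allSubsets k)
count-allSubsets {k} P? = begin
  length (filter P? (map (inside ∷_) A ++ map (outside ∷_) A))
    ≡⟨ cong length (filter-++ P? (map (inside ∷_) A) _) ⟩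
  length (filter P? (map (inside ∷_) A) ++ filter P? (map (outside ∷_) A))
    ≡⟨ length-++ (filter P? (map (inside ∷_) A)) ⟩
  count P? (map (inside ∷_) A) + count P? (map (outside ∷_) A)
    ≡⟨ cong₂ _+_ (count-map P? (inside ∷_) A) (count-map P? (outside ∷_) A) ⟩
  count (P? ∘ (inside ∷_)) A + count (P? ∘ (outside ∷_)) A ∎
  where
  open ≡-Reasoning
  A : List (Subset k)
  A = allSubsets k


ContainsLast : (m n : ℕ) → Pred (Subset (m + n)) 0ℓ
ContainsLast m n S = ∀ (j : Fin n) → m ↑ʳ j ∈ S

LastSubset : (m n i : ℕ) → Pred (Subset (m + n)) 0ℓ
LastSubset m n i S = ContainsLast m n S × ∣ S ∣ ≡ i

lastSubset? : ∀ m n i → Decidable (LastSubset m n i)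
lastSubset? m n i S = all? (λ j → m ↑ʳ j ∈? S) ×-dec (∣ S ∣ ≟ i)

lastCount : ℕ → ℕ → ℕ → ℕ
lastCount m n i = count (lastSubset? m n i) (allSubsets (m + n))

-- Whether the free element 0 of Fin (suc m + n) is chosen or not gives
-- Pascal's recurrence in m.
lastCount-Pascal : ∀ m n → Pascal (lastCount (suc m) n) (lastCount m n)
lastCount-Pascal m n = zero-case , suc-case
  where
  A : List (Subset (m + n))
  A = allSubsets (m + n)

  without0 : ∀ i → count (lastSubset? (suc m) n i ∘ (outside ∷_)) A ≡ lastCount m n i
  without0 i = count-≐ _ (lastSubset? m n i) A
    (λ (c , s) → (λ j → drop-there (c j)) , s)
    (λ (c , s) → (λ j → there (c j)) , s)

  with0 : ∀ i → count (lastSubset? (suc m) n (suc i) ∘ (inside ∷_)) A ≡ lastCount m n i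
  with0 i = count-≐ _ (lastSubset? m n i) A
    (λ (c , s) → (λ j → drop-there (c j)) , cong pred s)
    (λ (c , s) → (λ j → there (c j)) , cong suc s)

  zero-case : lastCount (suc m) n 0 ≡ lastCount m n 0
  zero-case = trans (count-allSubsets (lastSubset? (suc m) n 0))
    (cong₂ _+_ (count-none _ A λ _ ()) (without0 0))

  suc-case : ∀ i → lastCount (suc m) n (suc i) ≡ lastCount m n i + lastCount m n (suc i)
  suc-case i = trans (count-allSubsets (lastSubset? (suc m) n (suc i)))
    (cong₂ _+_ (with0 i) (without0 (suc i)))

-- With m = 0 the element 0 of Fin (suc n) is forced, which shifts the count.
lastCount-forced : ∀ n → lastCount 0 (suc n) ≗ shift 1 (lastCount 0 n)
lastCount-forced n i = begin
  lastCount 0 (suc n) i                             ≡⟨ count-allSubsets (lastSubset? 0 (suc n) i) ⟩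
  count (P? ∘ (inside ∷_)) A + count (P? ∘ (outside ∷_)) A
    ≡⟨ cong (count (P? ∘ (inside ∷_)) A +_) (count-none _ A λ _ (c , _) → outside∌0 (c zero)) ⟩
  count (P? ∘ (inside ∷_)) A + 0                     ≡⟨ +-identityʳ _ ⟩
  count (P? ∘ (inside ∷_)) A                         ≡⟨ with0 i ⟩
  shift 1 (lastCount 0 n) i                          ∎
  where
  open ≡-Reasoning
  P? : Decidable (LastSubset 0 (suc n) i)
  P? = lastSubset? 0 (suc n) i

  A : List (Subset n)
  A = allSubsets n

  outside∌0 : ∀ {S : Subset n} → ¬ (zero ∈ outside ∷ S)
  outside∌0 ()

  with0 : ∀ i → count (lastSubset? 0 (suc n) i ∘ (inside ∷_)) A ≡ shift 1 (lastCount 0 n) i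
  with0 zero    = count-none _ A λ _ ()
  with0 (suc i) = count-≐ _ (lastSubset? 0 n i) A
    (λ (c , s) → (λ j → drop-there (c (suc j))) , cong pred s)
    (λ (c , s) → (λ { zero → here ; (suc j) → there (c j) }) , cong suc s)

lastCount≡shift : ∀ m n → lastCount m n ≗ shift n (m C_)
lastCount≡shift zero zero    zero    = refl
lastCount≡shift zero zero    (suc i) = refl
lastCount≡shift zero (suc n) zero    = lastCount-forced n zero
lastCount≡shift zero (suc n) (suc i) =
  trans (lastCount-forced n (suc i)) (lastCount≡shift zero n i)
lastCount≡shift (suc m) n =
  Pascal-unique (lastCount-Pascal m n) (shift-Pascal n (binomial-Pascal m)) (lastCount≡shift m n)


-- In corona E the vertices are v_x = x ↑ˡ n and u_j = n ↑ʳ j, and the pendant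
-- edge {v_j , u_j} has index m ↑ʳ j.
module CoronaCovers {n m : ℕ} (E : Edges n m) where

  u≢v : ∀ (j x : Fin n) → n ↑ʳ j ≢ x ↑ˡ n
  u≢v j x eq with trans (sym (splitAt-↑ʳ n n j)) (trans (cong (splitAt n) eq) (splitAt-↑ˡ n x n))
  ... | ()

  corona-pendant : ∀ j → corona E (m ↑ʳ j) ≡ (j ↑ˡ n , n ↑ʳ j)
  corona-pendant j rewrite splitAt-↑ʳ m n j = refl

  only-pendant : ∀ k j → Incident (corona E k) (n ↑ʳ j) → k ≡ m ↑ʳ j
  only-pendant k j inc with splitAt m k in eq
  only-pendant k j (inj₁ u=v) | inj₁ _ = ⊥-elim (u≢v j _ u=v)
  only-pendant k j (inj₂ u=v) | inj₁ _ = ⊥-elim (u≢v j _ u=v)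
  only-pendant k j (inj₁ u=v) | inj₂ _ = ⊥-elim (u≢v j _ u=v)
  only-pendant k j (inj₂ u=u) | inj₂ l =
    trans (sym (splitAt⁻¹-↑ʳ eq)) (cong (m ↑ʳ_) (sym (↑ʳ-injective n j l u=u)))

  on-pendant : ∀ v → ∃ λ j → Incident (corona E (m ↑ʳ j)) v
  on-pendant v with splitAt n v in eq
  ... | inj₁ j = j , subst (λ edge → Incident edge v) (sym (corona-pendant j))
                           (inj₁ (sym (splitAt⁻¹-↑ˡ eq)))
  ... | inj₂ j = j , subst (λ edge → Incident edge v) (sym (corona-pendant j))
                           (inj₂ (sym (splitAt⁻¹-↑ʳ eq)))

  cover⇔pendants : ∀ S → IsEdgeCover (corona E) S ⇔ ContainsLast m n S
  cover⇔pendants S = mk⇔ to from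
    where
    to : IsEdgeCover (corona E) S → ContainsLast m n S
    to cover j with cover (n ↑ʳ j)
    ... | k , k∈S , inc = subst (_∈ S) (only-pendant k j inc) k∈S

    from : ContainsLast m n S → IsEdgeCover (corona E) S
    from pendants v with on-pendant v
    ... | j , inc = m ↑ʳ j , pendants j , inc

  e-corona : ∀ i → e (corona E) i ≡ lastCount m n i
  e-corona i = count-≐ _ (lastSubset? m n i) (allSubsets (m + n))
    (λ {S} (cover , s) → Equivalence.to (cover⇔pendants S) cover , s)
    (λ {S} (pendants , s) → Equivalence.from (cover⇔pendants S) pendants , s)


coeff-+ₚ : ∀ p q i → coeff (p +ₚ q) i ≡ coeff p i + coeff q i
coeff-+ₚ []      q       i       = refl
coeff-+ₚ (a ∷ p) []      i       = sym (+-identityʳ _)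
coeff-+ₚ (a ∷ p) (b ∷ q) zero    = refl
coeff-+ₚ (a ∷ p) (b ∷ q) (suc i) = coeff-+ₚ p q i

coeff-scale : ∀ a p i → coeff (map (a *_) p) i ≡ a * coeff p i
coeff-scale a []      i       = sym (*-zeroʳ a)
coeff-scale a (x ∷ p) zero    = refl
coeff-scale a (x ∷ p) (suc i) = coeff-scale a p i

coeff-*ₚ-cons : ∀ a p q i → coeff ((a ∷ p) *ₚ q) i ≡ a * coeff q i + coeff (0 ∷ (p *ₚ q)) i
coeff-*ₚ-cons a p q i =
  trans (coeff-+ₚ (map (a *_) q) _ i) (cong (_+ coeff (0 ∷ (p *ₚ q)) i) (coeff-scale a q i))

coeff-X^*ₚ : ∀ n q → coeff (X^ n *ₚ q) ≗ shift n (coeff q)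
coeff-X^*ₚ zero    q i       = begin
  coeff ((1 ∷ []) *ₚ q) i          ≡⟨ coeff-*ₚ-cons 1 [] q i ⟩
  1 * coeff q i + coeff (0 ∷ []) i ≡⟨ cong₂ _+_ (*-identityˡ _) (coeff-zero i) ⟩
  coeff q i + 0                    ≡⟨ +-identityʳ _ ⟩
  coeff q i                        ∎
  where
  open ≡-Reasoning
  coeff-zero : ∀ i → coeff (0 ∷ []) i ≡ 0
  coeff-zero zero    = refl
  coeff-zero (suc i) = refl
coeff-X^*ₚ (suc n) q zero    = coeff-*ₚ-cons 0 (X^ n) q zero
coeff-X^*ₚ (suc n) q (suc i) = trans (coeff-*ₚ-cons 0 (X^ n) q (suc i)) (coeff-X^*ₚ n q i)

coeff-1+X*ₚ : ∀ q → Pascal (coeff ((1 ∷ 1 ∷ []) *ₚ q)) (coeff q)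
coeff-1+X*ₚ q = at-zero , at-suc
  where
  at-zero : coeff ((1 ∷ 1 ∷ []) *ₚ q) 0 ≡ coeff q 0
  at-zero = trans (coeff-*ₚ-cons 1 (1 ∷ []) q 0) (trans (+-identityʳ _) (*-identityˡ _))

  at-suc : ∀ i → coeff ((1 ∷ 1 ∷ []) *ₚ q) (suc i) ≡ coeff q i + coeff q (suc i)
  at-suc i = begin
    coeff ((1 ∷ 1 ∷ []) *ₚ q) (suc i)           ≡⟨ coeff-*ₚ-cons 1 (1 ∷ []) q (suc i) ⟩
    1 * coeff q (suc i) + coeff (X^ 0 *ₚ q) i ≡⟨ cong₂ _+_ (*-identityˡ _) (coeff-X^*ₚ 0 q i) ⟩
    coeff q (suc i) + coeff q i                 ≡⟨ +-comm (coeff q (suc i)) _ ⟩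
    coeff q i + coeff q (suc i)                 ∎
    where open ≡-Reasoning

coeff-binomial : ∀ m → coeff ((1 ∷ 1 ∷ []) ^ₚ m) ≗ (m C_)
coeff-binomial zero    zero    = refl
coeff-binomial zero    (suc k) = refl
coeff-binomial (suc m) =
  Pascal-unique (coeff-1+X*ₚ ((1 ∷ 1 ∷ []) ^ₚ m)) (binomial-Pascal m) (coeff-binomial m)

coeff-X^[1+X]^ : ∀ n m → coeff (X^ n *ₚ ((1 ∷ 1 ∷ []) ^ₚ m)) ≗ shift n (m C_)
coeff-X^[1+X]^ n m i =
  trans (coeff-X^*ₚ n ((1 ∷ 1 ∷ []) ^ₚ m) i) (shift-cong n (coeff-binomial m) i)

shift-binomial-vanishes : ∀ n m {i} → m + n < i → shift n (m C_) i ≡ 0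
shift-binomial-vanishes n m {i} m+n<i =
  trans (shift-≥ n (m C_) n≤i) (k>n⇒nCk≡0 (m+n≤o⇒m≤o∸n (suc m) m+n<i))
  where
  n≤i : n ≤ i
  n≤i = ≤-trans (m≤n+m n m) (<⇒≤ m+n<i)

coeff-tabulate-< : ∀ k f {i} → i < k → coeff (map f (range k)) i ≡ f i
coeff-tabulate-< (suc k) f {zero}  _       = refl
coeff-tabulate-< (suc k) f {suc i} (s≤s p) =
  trans (cong (λ l → coeff l i) (sym (map-∘ (range k)))) (coeff-tabulate-< k (f ∘ suc) p)

coeff-tabulate-≥ : ∀ k f {i} → k ≤ i → coeff (map f (range k)) i ≡ 0
coeff-tabulate-≥ zero    f         _       = refl
coeff-tabulate-≥ (suc k) f {suc i} (s≤s p) =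
  trans (cong (λ l → coeff l i) (sym (map-∘ (range k)))) (coeff-tabulate-≥ k (f ∘ suc) p)


theorem2p2 : (n m : ℕ) (G : SimpleGraph n m) →
    ((i : ℕ) → n ≤ i → i ≤ n + m → e (corona (edge G)) i ≡ m C (i ∸ n))
    × (EdgeCoverPoly (corona (edge G)) ≈ₚ (X^ n *ₚ ((1 ∷ 1 ∷ []) ^ₚ m)))
theorem2p2 n m G = coefficients , polynomial
  where
  open CoronaCovers (edge G)

  e≡shift : ∀ i → e (corona (edge G)) i ≡ shift n (m C_) i
  e≡shift i = trans (e-corona i) (lastCount≡shift m n i)

  coefficients : (i : ℕ) → n ≤ i → i ≤ n + m → e (corona (edge G)) i ≡ m C (i ∸ n)
  coefficients i n≤i _ = trans (e≡shift i) (shift-≥ n (m C_) n≤i)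

  polynomial : EdgeCoverPoly (corona (edge G)) ≈ₚ (X^ n *ₚ ((1 ∷ 1 ∷ []) ^ₚ m))
  polynomial i with i <? suc (m + n)
  ... | yes i≤m+n = trans (coeff-tabulate-< (suc (m + n)) _ i≤m+n)
                          (trans (e≡shift i) (sym (coeff-X^[1+X]^ n m i)))
  ... | no i≰m+n  = trans (coeff-tabulate-≥ (suc (m + n)) _ (≮⇒≥ i≰m+n))
                          (sym (trans (coeff-X^[1+X]^ n m i)
                                      (shift-binomial-vanishes n m (≮⇒≥ i≰m+n))))
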